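{- Suppose that at some point in the $(K_{1,3}, P_\ell)$-online Ramsey game (for any $\ell$) the colored graph contains a blue copy of $P_k$ for some $k \ge 1$. Then Builder has a strategy such that after the next three rounds the colored graph contains either a blue copy of $P_{k+1}$ or a red copy of $K_{1,3}$.
   Context: In the $(G,H)$-online Ramsey game, two players, Builder and Painter, start from an infinite set of isolated vertices. In each round Builder draws an edge between two nonadjacent vertices and Painter immediately colors it red or blue. $K_{1,3}$ denotes the star with three edges, and $P_k$ denotes the path with $k$ vertices. -}

module Defs where

open import Data.Nat using (ℕ; zero; suc)
open import Data.Fin using (Fin; toℕ)
open import Data.List using (List; []; _∷_)
open import Data.List.Membership.Propositional using (_∈_)
open import Data.Product using (Σ; _×_; _,_; ∃-syntax)
open import Data.Sum using (_⊎_)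
open import Relation.Nullary using (¬_)
open import Relation.Binary.PropositionalEquality using (_≡_; _≢_)
open import Function.Definitions using (Injective)

data Colour : Set where
  red blue : Colour

-- A coloured graph on the (infinite) vertex set ℕ: the finite list of
-- coloured edges drawn so far.  An entry (u , v , c) is the edge uv of colour c.
ColouredGraph : Set
ColouredGraph = List (ℕ × ℕ × Colour)

HasEdge : ColouredGraph → Colour → ℕ → ℕ → Set
HasEdge G c u v = ((u , v , c) ∈ G) ⊎ ((v , u , c) ∈ G)

Adjacent : ColouredGraph → ℕ → ℕ → Set
Adjacent G u v = Σ Colour λ c → HasEdge G c u v

LegalMove : ColouredGraph → ℕ → ℕ → Set
LegalMove G u v = (u ≢ v) × ¬ Adjacent G u v

data Reachable : ColouredGraph → Set where
  start : Reachable []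
  round : ∀ {G} u v (c : Colour) → Reachable G → LegalMove G u v →
          Reachable ((u , v , c) ∷ G)

-- G contains a blue copy of the path P_k on k vertices:
-- k distinct vertices f 0, …, f (k-1) with f i f (i+1) blue for all i.
BluePath : ℕ → ColouredGraph → Set
BluePath k G =
  Σ (Fin k → ℕ) λ f → Injective _≡_ _≡_ f ×
    ((i j : Fin k) → toℕ j ≡ suc (toℕ i) → HasEdge G blue (f i) (f j))

RedClaw : ColouredGraph → Set
RedClaw G =
  Σ ℕ λ x → Σ ℕ λ a → Σ ℕ λ b → Σ ℕ λ d →
    (x ≢ a) × (x ≢ b) × (x ≢ d) × (a ≢ b) × (a ≢ d) × (b ≢ d) ×
    HasEdge G red x a × HasEdge G red x b × HasEdge G red x d

BuilderForces : ℕ → (ColouredGraph → Set) → ColouredGraph → Set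
BuilderForces zero    Goal G = Goal G
BuilderForces (suc n) Goal G =
  Σ ℕ λ u → Σ ℕ λ v → LegalMove G u v ×
    ((c : Colour) → BuilderForces n Goal ((u , v , c) ∷ G))

{-# OPTIONS --safe #-}
-- Builder joins the first vertex x of the blue path to a new vertex, up to
-- three times.  A blue answer extends the path by one vertex; three red
-- answers make x the centre of a red K_{1,3}.  Once the goal is reached,
-- Builder spends the remaining rounds on edges between new vertices, which
-- cannot destroy it.
module Submission where

open import Defs
open import Data.Nat using (ℕ; zero; suc; s≤s; _≤_; _<_)
open import Data.Nat.Properties using (<-irrefl; <⇒≢; n<1+n; m<n⇒m<1+n; suc-injective)
open import Data.Fin using (Fin; toℕ) renaming (zero to fzero; suc to fsuc)
open import Data.Fin.Properties using (toℕ-injective)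
open import Data.List using (List; []; _∷_; _++_; tabulate)
open import Data.List.Extrema.Nat using (max; xs≤max)
open import Data.List.Membership.Propositional using (_∈_; _∉_)
open import Data.List.Relation.Binary.Subset.Propositional using (_⊆_)
open import Data.List.Relation.Binary.Subset.Propositional.Properties
  using (⊆-refl; ⊆-trans; xs⊆x∷xs)
open import Data.List.Relation.Unary.All as All using (All; _∷_)
open import Data.List.Relation.Unary.All.Properties using (++⁻; tabulate⁻)
open import Data.List.Relation.Unary.Any using (here; there)
open import Data.Product as Product using (_,_; proj₁; proj₂; _×_)
open import Data.Sum as Sum using (_⊎_; inj₁; inj₂)
open import Data.Empty using (⊥-elim)
open import Function using (_∘_)
open import Function.Definitions using (Injective)
open import Relation.Nullary using (¬_)
open import Relation.Binary.PropositionalEquality using (_≡_; _≢_; refl; sym; cong)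

vertices : ColouredGraph → List ℕ
vertices []                = []
vertices ((u , v , _) ∷ G) = u ∷ v ∷ vertices G

∈⇒endpoints∈vertices : ∀ {G u v c} → (u , v , c) ∈ G →
                       u ∈ vertices G × v ∈ vertices G
∈⇒endpoints∈vertices (here refl) = here refl , there (here refl)
∈⇒endpoints∈vertices (there e∈G) =
  Product.map (there ∘ there) (there ∘ there) (∈⇒endpoints∈vertices e∈G)

∉vertices⇒¬Adjacent : ∀ {G u v} → v ∉ vertices G → ¬ Adjacent G u v
∉vertices⇒¬Adjacent v∉ (_ , inj₁ uv∈G) = v∉ (proj₂ (∈⇒endpoints∈vertices uv∈G))
∉vertices⇒¬Adjacent v∉ (_ , inj₂ vu∈G) = v∉ (proj₁ (∈⇒endpoints∈vertices vu∈G))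

All<⇒∉ : ∀ {w xs} → All (_< w) xs → w ∉ xs
All<⇒∉ xs<w w∈xs = <-irrefl refl (All.lookup xs<w w∈xs)

All<-1+max : (xs : List ℕ) → All (_< suc (max 0 xs)) xs
All<-1+max xs = All.map s≤s (xs≤max 0 xs)

All<-step : ∀ {w xs} → All (_< w) xs → All (_< suc w) xs
All<-step = All.map m<n⇒m<1+n

newVertex-legal : ∀ {G u w} → u < w → All (_< w) (vertices G) → LegalMove G u w
newVertex-legal u<w G<w = <⇒≢ u<w , ∉vertices⇒¬Adjacent (All<⇒∉ G<w)

HasEdge-mono : ∀ {G H c u v} → G ⊆ H → HasEdge G c u v → HasEdge H c u v
HasEdge-mono G⊆H = Sum.map G⊆H G⊆H

BluePath-mono : ∀ {k G H} → G ⊆ H → BluePath k G → BluePath k H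
BluePath-mono G⊆H (f , f-inj , edges) =
  f , f-inj , λ i j j≡1+i → HasEdge-mono G⊆H (edges i j j≡1+i)

RedClaw-mono : ∀ {G H} → G ⊆ H → RedClaw G → RedClaw H
RedClaw-mono G⊆H (x , a , b , d , x≢a , x≢b , x≢d , a≢b , a≢d , b≢d , xa , xb , xd) =
  x , a , b , d , x≢a , x≢b , x≢d , a≢b , a≢d , b≢d ,
  HasEdge-mono G⊆H xa , HasEdge-mono G⊆H xb , HasEdge-mono G⊆H xd

BluePath-cons : ∀ {k G H} (p : BluePath (suc k) G) {w} → G ⊆ H →
                (∀ i → proj₁ p i ≢ w) → HasEdge H blue w (proj₁ p fzero) →
                BluePath (suc (suc k)) H
BluePath-cons {k} {G} {H} (f , f-inj , edges) {w} G⊆H f≢w wf = g , g-inj , g-edges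
  where
  g : Fin (suc (suc k)) → ℕ
  g fzero    = w
  g (fsuc i) = f i

  g-inj : Injective _≡_ _≡_ g
  g-inj {fzero}  {fzero}  _  = refl
  g-inj {fzero}  {fsuc j} eq = ⊥-elim (f≢w j (sym eq))
  g-inj {fsuc i} {fzero}  eq = ⊥-elim (f≢w i eq)
  g-inj {fsuc i} {fsuc j} eq = cong fsuc (f-inj eq)

  g-edges : (i j : Fin (suc (suc k))) → toℕ j ≡ suc (toℕ i) → HasEdge H blue (g i) (g j)
  g-edges fzero    fzero    ()
  g-edges fzero    (fsuc j) 1≡1+j with toℕ-injective {i = j} {j = fzero} (suc-injective 1≡1+j)
  ... | refl = wf
  g-edges (fsuc i) fzero    ()
  g-edges (fsuc i) (fsuc j) j≡1+i = HasEdge-mono G⊆H (edges i j (suc-injective j≡1+i))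

RedClaw-fan : ∀ {H x w} → x < w →
              RedClaw ((x , suc (suc w) , red) ∷ (x , suc w , red) ∷ (x , w , red) ∷ H)
RedClaw-fan {w = w} x<w =
  _ , w , suc w , suc (suc w) ,
  <⇒≢ x<w , <⇒≢ x<1+w , <⇒≢ (m<n⇒m<1+n x<1+w) ,
  <⇒≢ (n<1+n w) , <⇒≢ (m<n⇒m<1+n (n<1+n w)) , <⇒≢ (n<1+n (suc w)) ,
  inj₁ (there (there (here refl))) , inj₁ (there (here refl)) , inj₁ (here refl)
  where x<1+w = m<n⇒m<1+n x<w

forces-by-waiting : (P : ColouredGraph → Set) → (∀ {H e} → P H → P (e ∷ H)) →
                    ∀ n {H} → P H → BuilderForces n P H
forces-by-waiting P P-mono zero    pH = pH
forces-by-waiting P P-mono (suc n) {H} pH =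
  u , suc u , newVertex-legal (n<1+n u) (All<-step (All<-1+max (vertices H))) ,
  λ _ → forces-by-waiting P P-mono n (P-mono pH)
  where u = suc (max 0 (vertices H))

module Probing {k G} (p : BluePath (suc k) G) where

  Goal : ColouredGraph → Set
  Goal H = BluePath (suc (suc k)) H ⊎ RedClaw H

  Goal-mono : ∀ {H e} → Goal H → Goal (e ∷ H)
  Goal-mono = Sum.map (BluePath-mono (xs⊆x∷xs _ _)) (RedClaw-mono (xs⊆x∷xs _ _))

  f : Fin (suc k) → ℕ
  f = proj₁ p

  x : ℕ
  x = f fzero

  Above : ColouredGraph → ℕ → Set
  Above H w = G ⊆ H × (∀ i → f i < w) × All (_< w) (vertices H)

  w₀ : ℕ
  w₀ = suc (max 0 (tabulate f ++ vertices G))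

  Above-start : Above G w₀
  Above-start = ⊆-refl , tabulate⁻ path<w₀ , G<w₀
    where
    path<w₀ = proj₁ (++⁻ (tabulate f) (All<-1+max (tabulate f ++ vertices G)))
    G<w₀    = proj₂ (++⁻ (tabulate f) (All<-1+max (tabulate f ++ vertices G)))

  x<w₀ : x < w₀
  x<w₀ = proj₁ (proj₂ Above-start) fzero

  Above-next : ∀ {H w c} → Above H w → Above ((x , w , c) ∷ H) (suc w)
  Above-next (G⊆H , f<w , H<w) =
    ⊆-trans G⊆H (xs⊆x∷xs _ _) , m<n⇒m<1+n ∘ f<w , m<n⇒m<1+n (f<w fzero) ∷ n<1+n _ ∷ All<-step H<w

  probe : ∀ n {H w} → Above H w → BuilderForces n Goal ((x , w , red) ∷ H) →
          BuilderForces (suc n) Goal H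
  probe n (G⊆H , f<w , H<w) onRed = x , _ , newVertex-legal (f<w fzero) H<w , λ
    { red  → onRed
    ; blue → forces-by-waiting Goal Goal-mono n (inj₁ (BluePath-cons p
               (⊆-trans G⊆H (xs⊆x∷xs _ _)) (<⇒≢ ∘ f<w) (inj₂ (here refl))))
    }

lemma3p1 : (G : ColouredGraph) → Reachable G → (k : ℕ) → 1 ≤ k →
    BluePath k G →
    BuilderForces 3 (λ H → BluePath (suc k) H ⊎ RedClaw H) G
lemma3p1 G _ (suc k) _ p =
  probe 2 Above-start (
  probe 1 (Above-next Above-start) (
  probe 0 (Above-next (Above-next Above-start)) (
  inj₂ (RedClaw-fan x<w₀))))
  where open Probing p
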